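{- Let $F$ be a finite field with $\mathrm{char}(F)\neq 2$, let $k\geq1$, and let $c_1,\ldots,c_k\in F$. Suppose \[P(x)=((\cdots((x^{2}-c_{1})^{2}-c_{2})^{2}\cdots)^{2}-c_{k-1})^{2}-c_{k}\in F[x]\] crumbles over $F$. If $j\in\{1,\ldots,k\}$ and $|F|\leq 2^{j-1}$, then $c_j=c_{j+1}=\cdots=c_k=0_F$.
   Context: A polynomial $P$ crumbles over a unique factorization domain (e.g. a field) $D$ if $P$ can be written as a product of (not necessarily distinct) linear polynomials in $D[x]$. -}

module Defs where

open import Level using (Level; _⊔_)
open import Data.Unit.Polymorphic using (⊤)
open import Algebra.Bundles using (CommutativeRing)
open import Data.Nat using (ℕ; zero; suc)
open import Data.Fin using (Fin)
open import Data.List using (List; []; _∷_; foldr)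
open import Data.Product using (Σ; ∃; _×_; _,_)
open import Relation.Nullary using (¬_)
open import Relation.Binary.PropositionalEquality using (_≡_)

record Field (c ℓ : Level) : Set (Level.suc (c ⊔ ℓ)) where
  field
    commutativeRing : CommutativeRing c ℓ
  open CommutativeRing commutativeRing public
  field
    1≉0     : ¬ (1# ≈ 0#)
    inverse : ∀ x → ¬ (x ≈ 0#) → Σ Carrier (λ y → (x * y) ≈ 1#)

module _ {c ℓ : Level} (F : Field c ℓ) where
  open Field F

  HasCardinality : ℕ → Set (c ⊔ ℓ)
  HasCardinality n =
    Σ (Fin n → Carrier) λ f →
      (∀ i j → f i ≈ f j → i ≡ j) × (∀ x → Σ (Fin n) λ i → f i ≈ x)

  CharNot2 : Set ℓ
  CharNot2 = ¬ ((1# + 1#) ≈ 0#)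

  -- Polynomials in F[x]: coefficient lists, constant term first.
  Poly : Set c
  Poly = List Carrier

  -- Equality of polynomials: coefficientwise, trailing zeros ignored.
  infix 4 _≈ₚ_
  _≈ₚ_ : Poly → Poly → Set ℓ
  []      ≈ₚ []      = ⊤
  []      ≈ₚ (b ∷ q) = (b ≈ 0#) × ([] ≈ₚ q)
  (a ∷ p) ≈ₚ []      = (a ≈ 0#) × (p ≈ₚ [])
  (a ∷ p) ≈ₚ (b ∷ q) = (a ≈ b) × (p ≈ₚ q)

  infixl 6 _+ₚ_
  _+ₚ_ : Poly → Poly → Poly
  []      +ₚ q       = q
  (a ∷ p) +ₚ []      = a ∷ p
  (a ∷ p) +ₚ (b ∷ q) = (a + b) ∷ (p +ₚ q)

  _·ₚ_ : Carrier → Poly → Poly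
  a ·ₚ []      = []
  a ·ₚ (b ∷ q) = (a * b) ∷ (a ·ₚ q)

  infixl 7 _*ₚ_
  _*ₚ_ : Poly → Poly → Poly
  []      *ₚ q = []
  (a ∷ p) *ₚ q = (a ·ₚ q) +ₚ (0# ∷ (p *ₚ q))

  constₚ : Carrier → Poly
  constₚ a = a ∷ []

  oneₚ : Poly
  oneₚ = constₚ 1#

  X : Poly
  X = 0# ∷ 1# ∷ []

  Linear : Set (c ⊔ ℓ)
  Linear = Σ (Carrier × Carrier) λ { (a , b) → ¬ (a ≈ 0#) }

  linPoly : Linear → Poly
  linPoly ((a , b) , _) = b ∷ a ∷ []

  Crumbles : Poly → Set (c ⊔ ℓ)
  Crumbles P = Σ (List Linear) λ ls →
    foldr (λ l acc → linPoly l *ₚ acc) oneₚ ls ≈ₚ P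

  -- The iterated polynomial
  --   P_0 = x,  P_m = (P_{m-1})² - c_m   (m ≥ 1),
  -- so P_k = ((⋯((x² - c₁)² - c₂)² ⋯)² - c_{k-1})² - c_k.
  -- Only the values c 1, …, c k matter for P_k.
  iterPoly : (ℕ → Carrier) → ℕ → Poly
  iterPoly cs zero    = X
  iterPoly cs (suc m) = (iterPoly cs m *ₚ iterPoly cs m) +ₚ constₚ (- cs (suc m))

module Submission where

-- Write P₀ = x, P_{t+1} = P_t² - c_{t+1} and step t (y) = y² - c_{t+1}, so
-- that P_{t+d}(x) is obtained from P_t(x) by applying step t, …, step (t+d-1).
-- Suppose P_k crumbles but some c_i ≉ 0 with j ≤ i ≤ k, and let c_{s+1} be the
-- last nonzero constant (s + 1 ≥ j).  Key fact (value-of-P): if these steps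
-- carry z to 0, then P_t - z divides P_k, so it has a root (a nonconstant
-- divisor of a product of linear factors has a root), i.e. z is a value of
-- P_t and hence z = step (t-1) (w) for some w.  As step t is even and w ≉ -w
-- for w ≉ 0 (char ≠ 2), going down one level roughly doubles the number of
-- elements carried to 0: starting from {0} at level s + 1, where step s 0 =
-- -c_{s+1} ≉ 0, level s has two of them and level s - g more than 2^g.  So
-- |F| > 2^s ≥ 2^(j-1), a contradiction.

open import Defs
open import Level using (Level; _⊔_)
open import Data.Nat using (ℕ; zero; suc; _≤_; _<_; _∸_; _^_; s≤s; z≤n)
  renaming (_+_ to _+ℕ_)
open import Data.Nat.Properties as ℕ using ()
open import Data.List using (List; []; _∷_; length; foldr; lookup)
import Data.List.Relation.Unary.All as All
open import Data.List.Membership.Propositional.Properties using (∈-lookup)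
import Data.Fin as Fin
import Data.Fin.Properties as Fin
open import Data.Product as Product using (Σ; _×_; _,_; proj₁; proj₂)
open import Data.Sum using (_⊎_; inj₁; inj₂)
open import Data.Empty using (⊥; ⊥-elim)
open import Relation.Nullary using (¬_; Dec; yes; no)
open import Relation.Nullary.Decidable using (decidable-stable)
open import Relation.Binary.PropositionalEquality as ≡ using (_≡_)
open import Relation.Binary.Bundles using (Setoid)
import Relation.Binary.Reasoning.Setoid as SetoidReasoning

last-failure : ∀ {p} {Q : ℕ → Set p} → (∀ m → Dec (Q m)) → ∀ {i k} → i ≤ k → ¬ Q i →
               Σ ℕ λ m → i ≤ m × m ≤ k × ¬ Q m × (∀ n → m < n → n ≤ k → Q n)
last-failure Q? {i} {zero} i≤0 ¬Qi =
  i , ℕ.≤-refl , i≤0 , ¬Qi , λ n i<n n≤0 → ⊥-elim (ℕ.<⇒≱ (ℕ.<-≤-trans i<n n≤0) z≤n)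
last-failure {Q = Q} Q? {i} {suc k} i≤1+k ¬Qi with Q? (suc k)
... | no ¬Q1+k = suc k , i≤1+k , ℕ.≤-refl , ¬Q1+k , λ n 1+k<n n≤1+k → ⊥-elim (ℕ.<⇒≱ 1+k<n n≤1+k)
... | yes Q1+k with ℕ.m≤n⇒m<n∨m≡n i≤1+k
...   | inj₂ ≡.refl = ⊥-elim (¬Qi Q1+k)
...   | inj₁ (s≤s i≤k) with last-failure Q? i≤k ¬Qi
...     | m , i≤m , m≤k , ¬Qm , holds-after = m , i≤m , ℕ.m≤n⇒m≤1+n m≤k , ¬Qm , holds-after′
  where
  holds-after′ : ∀ n → m < n → n ≤ suc k → Q n
  holds-after′ n m<n n≤1+k with ℕ.m≤n⇒m<n∨m≡n n≤1+k
  ... | inj₁ (s≤s n≤k) = holds-after n m<n n≤k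
  ... | inj₂ ≡.refl    = Q1+k

module FieldFacts {c ℓ : Level} (F : Field c ℓ) where
  open Field F hiding (zero)
  open import Data.List.Relation.Unary.Unique.Setoid setoid using (Unique)
  open import Data.List.Relation.Unary.AllPairs using (_∷_)
  module ≈-Reasoning = SetoidReasoning setoid

  nonzero-cancel : ∀ {x y} → ¬ x ≈ 0# → x * y ≈ 0# → y ≈ 0#
  nonzero-cancel {x} {y} x≉0 xy≈0 with inverse x x≉0
  ... | x⁻¹ , xx⁻¹≈1 = begin
    y                ≈⟨ *-identityˡ y ⟨
    1# * y           ≈⟨ *-congʳ (trans (sym xx⁻¹≈1) (*-comm x x⁻¹)) ⟩
    (x⁻¹ * x) * y    ≈⟨ *-assoc x⁻¹ x y ⟩
    x⁻¹ * (x * y)    ≈⟨ *-congˡ xy≈0 ⟩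
    x⁻¹ * 0#         ≈⟨ zeroʳ x⁻¹ ⟩
    0#               ∎
    where open ≈-Reasoning

  nonzero-* : ∀ {x y} → ¬ x ≈ 0# → ¬ y ≈ 0# → ¬ (x * y) ≈ 0#
  nonzero-* x≉0 y≉0 xy≈0 = y≉0 (nonzero-cancel x≉0 xy≈0)

  nonzero≉neg : CharNot2 F → ∀ {w} → ¬ w ≈ 0# → ¬ w ≈ - w
  nonzero≉neg 2≉0 {w} w≉0 w≈-w = w≉0 (nonzero-cancel 2≉0 (begin
    (1# + 1#) * w      ≈⟨ distribʳ w 1# 1# ⟩
    1# * w + 1# * w    ≈⟨ +-cong (*-identityˡ w) (*-identityˡ w) ⟩
    w + w              ≈⟨ +-congˡ w≈-w ⟩
    w + - w            ≈⟨ -‿inverseʳ w ⟩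
    0#                 ∎))
    where open ≈-Reasoning

  -- A finite field has decidable equality: compare indices in Fin q.
  finite⇒decidable : ∀ {q} → HasCardinality F q → ∀ x y → Dec (x ≈ y)
  finite⇒decidable (enum , enum-inj , index) x y
    with proj₁ (index x) Fin.≟ proj₁ (index y)
  ... | yes i≡j = yes (trans (sym (proj₂ (index x)))
                        (trans (reflexive (≡.cong enum i≡j)) (proj₂ (index y))))
  ... | no  i≢j = no λ x≈y → i≢j (enum-inj _ _
                        (trans (proj₂ (index x)) (trans x≈y (sym (proj₂ (index y))))))

  unique-length : ∀ {q} → HasCardinality F q → ∀ xs → Unique xs → length xs ≤ q
  unique-length {q} (enum , _ , index) xs xs! with length xs ℕ.≤? q
  ... | yes ok = ok
  ... | no  ¬ok with Fin.pigeonhole (ℕ.≰⇒> ¬ok) (λ i → proj₁ (index (lookup xs i)))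
  ...   | i , j , i<j , same = ⊥-elim (distinct xs xs! i<j (begin
          lookup xs i                       ≈⟨ proj₂ (index (lookup xs i)) ⟨
          enum (proj₁ (index (lookup xs i))) ≈⟨ reflexive (≡.cong enum same) ⟩
          enum (proj₁ (index (lookup xs j))) ≈⟨ proj₂ (index (lookup xs j)) ⟩
          lookup xs j                       ∎))
    where
    open ≈-Reasoning
    distinct : ∀ ys → Unique ys → ∀ {i j} → i Fin.< j → ¬ lookup ys i ≈ lookup ys j
    distinct (y ∷ ys) (y≉ys ∷ _)   {Fin.zero}  {Fin.suc j} _ = All.lookup y≉ys (∈-lookup j)
    distinct (y ∷ ys) (_ ∷ ys!)    {Fin.suc i} {Fin.suc j} (s≤s i<j) = distinct ys ys! i<j

-- Counting preimages under an even map f (f(-w) ≈ f(w)) of a field of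
-- characteristic ≠ 2: every target z = f(w) has the two preimages w ≉ -w,
-- except z = f(0).
module EvenMaps {c ℓ : Level} (F : Field c ℓ) (2≉0 : CharNot2 F)
                (_≟_ : ∀ x y → Dec (Field._≈_ F x y))
                (f : Field.Carrier F → Field.Carrier F)
                (f-cong : ∀ {x y} → Field._≈_ F x y → Field._≈_ F (f x) (f y))
                (f-even : ∀ w → Field._≈_ F (f (Field.-_ F w)) (f w)) where
  open Field F hiding (zero)
  open FieldFacts F using (nonzero≉neg)
  open import Data.List.Relation.Unary.Unique.Setoid setoid using (Unique)
  open import Data.List.Relation.Unary.AllPairs using ([]; _∷_)
  open import Data.List.Membership.Setoid setoid using (_∈_)
  open import Data.List.Membership.Setoid.Properties using (∈-resp-≈)
  open import Data.List.Relation.Unary.All.Properties using (All¬⇒¬Any)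
  open import Data.List.Relation.Unary.Any using (here; there)
  open All using (All; []; _∷_)

  InImage : Carrier → Set (c ⊔ ℓ)
  InImage z = Σ Carrier λ w → f w ≈ z

  record PreimageList (D : List Carrier) : Set (c ⊔ ℓ) where
    constructor preimageList
    field
      elements  : List Carrier
      distinct  : Unique elements
      maps-into : All (λ u → f u ∈ D) elements
  open PreimageList

  none : PreimageList []
  none = preimageList [] [] []

  fresh : ∀ {z u Dr} → All (λ y → ¬ z ≈ y) Dr → f u ≈ z → (E : PreimageList Dr) →
          All (λ v → ¬ u ≈ v) (elements E)
  fresh z∉Dr fu≈z E = All.map (λ fv∈Dr u≈v →
    All¬⇒¬Any z∉Dr (∈-resp-≈ setoid (trans (f-cong (sym u≈v)) fu≈z) fv∈Dr)) (maps-into E)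

  adjoin-one : ∀ {z Dr} w → f w ≈ z → All (λ y → ¬ z ≈ y) Dr →
               PreimageList Dr → PreimageList (z ∷ Dr)
  adjoin-one w fw≈z z∉Dr E = preimageList (w ∷ elements E)
    (fresh z∉Dr fw≈z E ∷ distinct E)
    (here fw≈z ∷ All.map there (maps-into E))

  adjoin-pair : ∀ {z Dr} w → ¬ w ≈ 0# → f w ≈ z → All (λ y → ¬ z ≈ y) Dr →
                PreimageList Dr → PreimageList (z ∷ Dr)
  adjoin-pair {z} w w≉0 fw≈z z∉Dr E = preimageList (w ∷ - w ∷ elements E)
    ((nonzero≉neg 2≉0 w≉0 ∷ fresh z∉Dr fw≈z E) ∷ fresh z∉Dr f-w≈z E ∷ distinct E)
    (here fw≈z ∷ here f-w≈z ∷ All.map there (maps-into E))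
    where
    f-w≈z : f (- w) ≈ z
    f-w≈z = trans (f-even w) fw≈z

  double-suc : ∀ {n m} → n +ℕ n ≤ m → suc n +ℕ suc n ≤ suc (suc m)
  double-suc {n} le = s≤s (ℕ.≤-trans (ℕ.≤-reflexive (ℕ.+-suc n n)) (s≤s le))

  preimages-avoiding : ∀ D → Unique D → All InImage D → All (λ z → ¬ f 0# ≈ z) D →
                       Σ (PreimageList D) λ E → length D +ℕ length D ≤ length (elements E)
  preimages-avoiding []       _          _                    _                = none , z≤n
  preimages-avoiding (z ∷ Dr) (z∉Dr ∷ Dr!) ((w , fw≈z) ∷ Dr-img) (f0≉z ∷ Dr-avoid)
    with preimages-avoiding Dr Dr! Dr-img Dr-avoid
  ... | E , size = adjoin-pair w w≉0 fw≈z z∉Dr E , double-suc size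
    where
    w≉0 : ¬ w ≈ 0#
    w≉0 w≈0 = f0≉z (trans (f-cong (sym w≈0)) fw≈z)

  preimages : ∀ D → Unique D → All InImage D →
              Σ (PreimageList D) λ E → length D +ℕ length D ≤ suc (length (elements E))
  preimages []       _          _                    = none , z≤n
  preimages (z ∷ Dr) (z∉Dr ∷ Dr!) ((w , fw≈z) ∷ Dr-img) with w ≟ 0#
  ... | no w≉0 with preimages Dr Dr! Dr-img
  ...   | E , size = adjoin-pair w w≉0 fw≈z z∉Dr E , double-suc size
  preimages (z ∷ Dr) (z∉Dr ∷ Dr!) ((w , fw≈z) ∷ Dr-img) | yes w≈0
    with preimages-avoiding Dr Dr! Dr-img (All.map (λ z≉y f0≈y → z≉y (trans z≈f0 f0≈y)) z∉Dr)
    where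
    z≈f0 : z ≈ f 0#
    z≈f0 = trans (sym fw≈z) (f-cong w≈0)
  ... | E , size = adjoin-one w fw≈z z∉Dr E , double-suc size

module Polynomials {c ℓ : Level} (F : Field c ℓ) where
  open Field F hiding (zero)
  open FieldFacts F using (nonzero-cancel; nonzero-*)
  open import Algebra.Properties.Ring ring using (-‿distribˡ-*; -‿distribʳ-*; -‿involutive)
  open import Algebra.Properties.CommutativeSemigroup +-commutativeSemigroup
    using (interchange)
  open import Algebra.Properties.CommutativeSemigroup *-commutativeSemigroup
    using (x∙yz≈y∙xz)
  module ≈-Reasoning = SetoidReasoning setoid

  infixl 6 _⊕_
  infixl 7 _⊗_
  infixr 8 _⊙_

  _⊕_ : Poly F → Poly F → Poly F
  _⊕_ = _+ₚ_ F

  _⊗_ : Poly F → Poly F → Poly F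
  _⊗_ = _*ₚ_ F

  _⊙_ : Carrier → Poly F → Poly F
  _⊙_ = _·ₚ_ F

  coef : Poly F → ℕ → Carrier
  coef []      n       = 0#
  coef (a ∷ p) zero    = a
  coef (a ∷ p) (suc n) = coef p n

  -- Coefficientwise equality: a form of the polynomial equality _≈ₚ_ that is
  -- convenient to reason with (see ≈ₚ⇒≋).
  infix 4 _≋_
  record _≋_ (p q : Poly F) : Set ℓ where
    constructor coefwise
    field at : ∀ n → coef p n ≈ coef q n
  open _≋_ public

  ≋-refl : ∀ {p} → p ≋ p
  ≋-refl = coefwise λ _ → refl

  ≋-sym : ∀ {p q} → p ≋ q → q ≋ p
  ≋-sym e = coefwise λ n → sym (at e n)

  ≋-trans : ∀ {p q r} → p ≋ q → q ≋ r → p ≋ r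
  ≋-trans e f = coefwise λ n → trans (at e n) (at f n)

  ≋-setoid : Setoid c ℓ
  ≋-setoid = record
    { _≈_ = _≋_
    ; isEquivalence = record { refl = ≋-refl ; sym = ≋-sym ; trans = ≋-trans } }

  module ≋-Reasoning = SetoidReasoning ≋-setoid

  ∷-cong : ∀ {a b p q} → a ≈ b → p ≋ q → a ∷ p ≋ b ∷ q
  ∷-cong e f = coefwise λ { zero → e ; (suc n) → at f n }

  ∷-tail : ∀ {a b p q} → a ∷ p ≋ b ∷ q → p ≋ q
  ∷-tail e = coefwise λ n → at e (suc n)

  []≋0∷[] : [] ≋ 0# ∷ []
  []≋0∷[] = coefwise λ { zero → refl ; (suc n) → refl }

  ≈ₚ⇒≋ : ∀ {p q} → _≈ₚ_ F p q → p ≋ q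
  ≈ₚ⇒≋ {[]}    {[]}    _         = ≋-refl
  ≈ₚ⇒≋ {[]}    {b ∷ q} (b≈0 , e) = ≋-trans []≋0∷[] (∷-cong (sym b≈0) (≈ₚ⇒≋ e))
  ≈ₚ⇒≋ {a ∷ p} {[]}    (a≈0 , e) = ≋-trans (∷-cong a≈0 (≈ₚ⇒≋ e)) (≋-sym []≋0∷[])
  ≈ₚ⇒≋ {a ∷ p} {b ∷ q} (a≈b , e) = ∷-cong a≈b (≈ₚ⇒≋ e)

  coef-⊕ : ∀ p q n → coef (p ⊕ q) n ≈ coef p n + coef q n
  coef-⊕ []      q       n       = sym (+-identityˡ _)
  coef-⊕ (a ∷ p) []      n       = sym (+-identityʳ _)
  coef-⊕ (a ∷ p) (b ∷ q) zero    = refl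
  coef-⊕ (a ∷ p) (b ∷ q) (suc n) = coef-⊕ p q n

  coef-⊙ : ∀ a p n → coef (a ⊙ p) n ≈ a * coef p n
  coef-⊙ a []      n       = sym (zeroʳ a)
  coef-⊙ a (b ∷ p) zero    = refl
  coef-⊙ a (b ∷ p) (suc n) = coef-⊙ a p n

  ⊕-cong : ∀ {p p′ q q′} → p ≋ p′ → q ≋ q′ → p ⊕ q ≋ p′ ⊕ q′
  ⊕-cong {p} {p′} {q} {q′} e f = coefwise λ n →
    trans (coef-⊕ p q n) (trans (+-cong (at e n) (at f n)) (sym (coef-⊕ p′ q′ n)))

  ⊕-comm : ∀ p q → p ⊕ q ≋ q ⊕ p
  ⊕-comm p q = coefwise λ n →
    trans (coef-⊕ p q n) (trans (+-comm _ _) (sym (coef-⊕ q p n)))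

  ⊕-assoc : ∀ p q r → (p ⊕ q) ⊕ r ≋ p ⊕ (q ⊕ r)
  ⊕-assoc p q r = coefwise λ n → begin
    coef ((p ⊕ q) ⊕ r) n              ≈⟨ coef-⊕ (p ⊕ q) r n ⟩
    coef (p ⊕ q) n + coef r n         ≈⟨ +-congʳ (coef-⊕ p q n) ⟩
    (coef p n + coef q n) + coef r n  ≈⟨ +-assoc _ _ _ ⟩
    coef p n + (coef q n + coef r n)  ≈⟨ +-congˡ (coef-⊕ q r n) ⟨
    coef p n + coef (q ⊕ r) n         ≈⟨ coef-⊕ p (q ⊕ r) n ⟨
    coef (p ⊕ (q ⊕ r)) n              ∎
    where open ≈-Reasoning

  ⊕-interchange : ∀ p q r s → (p ⊕ q) ⊕ (r ⊕ s) ≋ (p ⊕ r) ⊕ (q ⊕ s)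
  ⊕-interchange p q r s = coefwise λ n → begin
    coef ((p ⊕ q) ⊕ (r ⊕ s)) n                          ≈⟨ coef-⊕ (p ⊕ q) (r ⊕ s) n ⟩
    coef (p ⊕ q) n + coef (r ⊕ s) n                     ≈⟨ +-cong (coef-⊕ p q n) (coef-⊕ r s n) ⟩
    (coef p n + coef q n) + (coef r n + coef s n)       ≈⟨ interchange _ _ _ _ ⟩
    (coef p n + coef r n) + (coef q n + coef s n)       ≈⟨ +-cong (coef-⊕ p r n) (coef-⊕ q s n) ⟨
    coef (p ⊕ r) n + coef (q ⊕ s) n                     ≈⟨ coef-⊕ (p ⊕ r) (q ⊕ s) n ⟨
    coef ((p ⊕ r) ⊕ (q ⊕ s)) n                          ∎
    where open ≈-Reasoning

  ⊕-zeroˡ : ∀ {p} q → p ≋ [] → p ⊕ q ≋ q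
  ⊕-zeroˡ {p} q z = coefwise λ n →
    trans (coef-⊕ p q n) (trans (+-congʳ (at z n)) (+-identityˡ _))

  ⊕-zeroʳ : ∀ p {q} → q ≋ [] → p ⊕ q ≋ p
  ⊕-zeroʳ p {q} z = ≋-trans (⊕-comm p q) (⊕-zeroˡ p z)

  shift-⊕ : ∀ p q → 0# ∷ (p ⊕ q) ≋ (0# ∷ p) ⊕ (0# ∷ q)
  shift-⊕ p q = ∷-cong (sym (+-identityʳ 0#)) ≋-refl

  ⊙-cong : ∀ {a b p q} → a ≈ b → p ≋ q → a ⊙ p ≋ b ⊙ q
  ⊙-cong {a} {b} {p} {q} e f = coefwise λ n →
    trans (coef-⊙ a p n) (trans (*-cong e (at f n)) (sym (coef-⊙ b q n)))

  ⊙-distribˡ : ∀ a p q → a ⊙ (p ⊕ q) ≋ a ⊙ p ⊕ a ⊙ q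
  ⊙-distribˡ a p q = coefwise λ n → begin
    coef (a ⊙ (p ⊕ q)) n                 ≈⟨ coef-⊙ a (p ⊕ q) n ⟩
    a * coef (p ⊕ q) n                   ≈⟨ *-congˡ (coef-⊕ p q n) ⟩
    a * (coef p n + coef q n)            ≈⟨ distribˡ _ _ _ ⟩
    a * coef p n + a * coef q n          ≈⟨ +-cong (coef-⊙ a p n) (coef-⊙ a q n) ⟨
    coef (a ⊙ p) n + coef (a ⊙ q) n      ≈⟨ coef-⊕ (a ⊙ p) (a ⊙ q) n ⟨
    coef (a ⊙ p ⊕ a ⊙ q) n               ∎
    where open ≈-Reasoning

  ⊙-distribʳ : ∀ a b p → (a + b) ⊙ p ≋ a ⊙ p ⊕ b ⊙ p
  ⊙-distribʳ a b p = coefwise λ n → begin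
    coef ((a + b) ⊙ p) n                 ≈⟨ coef-⊙ (a + b) p n ⟩
    (a + b) * coef p n                   ≈⟨ distribʳ _ _ _ ⟩
    a * coef p n + b * coef p n          ≈⟨ +-cong (coef-⊙ a p n) (coef-⊙ b p n) ⟨
    coef (a ⊙ p) n + coef (b ⊙ p) n      ≈⟨ coef-⊕ (a ⊙ p) (b ⊙ p) n ⟨
    coef (a ⊙ p ⊕ b ⊙ p) n               ∎
    where open ≈-Reasoning

  ⊙-assoc : ∀ a b p → a ⊙ (b ⊙ p) ≋ (a * b) ⊙ p
  ⊙-assoc a b p = coefwise λ n → begin
    coef (a ⊙ (b ⊙ p)) n   ≈⟨ coef-⊙ a (b ⊙ p) n ⟩
    a * coef (b ⊙ p) n     ≈⟨ *-congˡ (coef-⊙ b p n) ⟩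
    a * (b * coef p n)     ≈⟨ *-assoc _ _ _ ⟨
    (a * b) * coef p n     ≈⟨ coef-⊙ (a * b) p n ⟨
    coef ((a * b) ⊙ p) n   ∎
    where open ≈-Reasoning

  ⊙-comm : ∀ a b p → a ⊙ (b ⊙ p) ≋ b ⊙ (a ⊙ p)
  ⊙-comm a b p =
    ≋-trans (⊙-assoc a b p) (≋-trans (⊙-cong (*-comm a b) ≋-refl) (≋-sym (⊙-assoc b a p)))

  ⊙-identity : ∀ p → 1# ⊙ p ≋ p
  ⊙-identity p = coefwise λ n → trans (coef-⊙ 1# p n) (*-identityˡ _)

  ⊙-zero : ∀ p → 0# ⊙ p ≋ []
  ⊙-zero p = coefwise λ n → trans (coef-⊙ 0# p n) (zeroˡ _)

  ⊖_ : Poly F → Poly F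
  ⊖ p = (- 1#) ⊙ p

  ⊕-inverseʳ : ∀ p → p ⊕ ⊖ p ≋ []
  ⊕-inverseʳ p = ≋-trans (⊕-cong (≋-sym (⊙-identity p)) ≋-refl)
    (≋-trans (≋-sym (⊙-distribʳ 1# (- 1#) p))
    (≋-trans (⊙-cong (-‿inverseʳ 1#) ≋-refl) (⊙-zero p)))

  ⊗-zeroˡ : ∀ p q → p ≋ [] → p ⊗ q ≋ []
  ⊗-zeroˡ []      q z = ≋-refl
  ⊗-zeroˡ (a ∷ p) q z = ≋-trans
    (⊕-zeroˡ (0# ∷ (p ⊗ q)) (≋-trans (⊙-cong (at z zero) ≋-refl) (⊙-zero q)))
    (≋-trans (∷-cong refl (⊗-zeroˡ p q (∷-tail (≋-trans z []≋0∷[])))) (≋-sym []≋0∷[]))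

  ⊗-zeroʳ : ∀ p → p ⊗ [] ≋ []
  ⊗-zeroʳ []      = ≋-refl
  ⊗-zeroʳ (a ∷ p) = ≋-trans (∷-cong refl (⊗-zeroʳ p)) (≋-sym []≋0∷[])

  ⊗-congˡ : ∀ {p p′} q → p ≋ p′ → p ⊗ q ≋ p′ ⊗ q
  ⊗-congˡ {[]}    {[]}     q e = ≋-refl
  ⊗-congˡ {[]}    {b ∷ p′} q e = ≋-sym (⊗-zeroˡ (b ∷ p′) q (≋-sym e))
  ⊗-congˡ {a ∷ p} {[]}     q e = ⊗-zeroˡ (a ∷ p) q e
  ⊗-congˡ {a ∷ p} {b ∷ p′} q e =
    ⊕-cong (⊙-cong (at e zero) ≋-refl) (∷-cong refl (⊗-congˡ q (∷-tail e)))

  ⊗-congʳ : ∀ p {q q′} → q ≋ q′ → p ⊗ q ≋ p ⊗ q′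
  ⊗-congʳ []      e = ≋-refl
  ⊗-congʳ (a ∷ p) e = ⊕-cong (⊙-cong refl e) (∷-cong refl (⊗-congʳ p e))

  ⊗-distribʳ : ∀ p q r → (p ⊕ q) ⊗ r ≋ p ⊗ r ⊕ q ⊗ r
  ⊗-distribʳ []      q       r = ≋-refl
  ⊗-distribʳ (a ∷ p) []      r = ≋-sym (⊕-zeroʳ ((a ∷ p) ⊗ r) ≋-refl)
  ⊗-distribʳ (a ∷ p) (b ∷ q) r = ≋-trans
    (⊕-cong (⊙-distribʳ a b r) (≋-trans (∷-cong refl (⊗-distribʳ p q r)) (shift-⊕ (p ⊗ r) (q ⊗ r))))
    (⊕-interchange (a ⊙ r) (b ⊙ r) (0# ∷ (p ⊗ r)) (0# ∷ (q ⊗ r)))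

  ⊗-⊙ˡ : ∀ a p q → (a ⊙ p) ⊗ q ≋ a ⊙ (p ⊗ q)
  ⊗-⊙ˡ a []      q = ≋-refl
  ⊗-⊙ˡ a (b ∷ p) q = begin
    (a * b) ⊙ q ⊕ (0# ∷ ((a ⊙ p) ⊗ q))   ≈⟨ ⊕-cong (≋-sym (⊙-assoc a b q)) (∷-cong (sym (zeroʳ a)) (⊗-⊙ˡ a p q)) ⟩
    a ⊙ (b ⊙ q) ⊕ a ⊙ (0# ∷ (p ⊗ q))     ≈⟨ ⊙-distribˡ a (b ⊙ q) (0# ∷ (p ⊗ q)) ⟨
    a ⊙ (b ⊙ q ⊕ (0# ∷ (p ⊗ q)))         ∎
    where open ≋-Reasoning

  ⊗-⊙ʳ : ∀ a p q → p ⊗ (a ⊙ q) ≋ a ⊙ (p ⊗ q)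
  ⊗-⊙ʳ a []      q = ≋-refl
  ⊗-⊙ʳ a (b ∷ p) q = begin
    b ⊙ (a ⊙ q) ⊕ (0# ∷ (p ⊗ (a ⊙ q)))   ≈⟨ ⊕-cong (⊙-comm b a q) (∷-cong (sym (zeroʳ a)) (⊗-⊙ʳ a p q)) ⟩
    a ⊙ (b ⊙ q) ⊕ a ⊙ (0# ∷ (p ⊗ q))     ≈⟨ ⊙-distribˡ a (b ⊙ q) (0# ∷ (p ⊗ q)) ⟨
    a ⊙ (b ⊙ q ⊕ (0# ∷ (p ⊗ q)))         ∎
    where open ≋-Reasoning

  ⊗-∷ʳ : ∀ p b q → p ⊗ (b ∷ q) ≋ b ⊙ p ⊕ (0# ∷ (p ⊗ q))
  ⊗-∷ʳ []      b q = []≋0∷[]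
  ⊗-∷ʳ (a ∷ p) b q = ∷-cong (trans (+-identityʳ _) (trans (*-comm a b) (sym (+-identityʳ _)))) (begin
    a ⊙ q ⊕ p ⊗ (b ∷ q)                    ≈⟨ ⊕-cong (≋-refl {a ⊙ q}) (⊗-∷ʳ p b q) ⟩
    a ⊙ q ⊕ (b ⊙ p ⊕ (0# ∷ (p ⊗ q)))       ≈⟨ ⊕-assoc (a ⊙ q) (b ⊙ p) _ ⟨
    (a ⊙ q ⊕ b ⊙ p) ⊕ (0# ∷ (p ⊗ q))       ≈⟨ ⊕-cong (⊕-comm (a ⊙ q) (b ⊙ p)) ≋-refl ⟩
    (b ⊙ p ⊕ a ⊙ q) ⊕ (0# ∷ (p ⊗ q))       ≈⟨ ⊕-assoc (b ⊙ p) (a ⊙ q) _ ⟩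
    b ⊙ p ⊕ (a ⊙ q ⊕ (0# ∷ (p ⊗ q)))       ∎)
    where open ≋-Reasoning

  ⊗-comm : ∀ p q → p ⊗ q ≋ q ⊗ p
  ⊗-comm []      q = ≋-sym (⊗-zeroʳ q)
  ⊗-comm (a ∷ p) q =
    ≋-trans (⊕-cong (≋-refl {a ⊙ q}) (∷-cong refl (⊗-comm p q))) (≋-sym (⊗-∷ʳ q a p))

  ⊗-distribˡ : ∀ p q r → p ⊗ (q ⊕ r) ≋ p ⊗ q ⊕ p ⊗ r
  ⊗-distribˡ p q r = ≋-trans (⊗-comm p (q ⊕ r))
    (≋-trans (⊗-distribʳ q r p) (⊕-cong (⊗-comm q p) (⊗-comm r p)))

  ⊗-assoc : ∀ p q r → (p ⊗ q) ⊗ r ≋ p ⊗ (q ⊗ r)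
  ⊗-assoc []      q r = ≋-refl
  ⊗-assoc (a ∷ p) q r = ≋-trans (⊗-distribʳ (a ⊙ q) (0# ∷ (p ⊗ q)) r)
    (⊕-cong (⊗-⊙ˡ a q r)
      (≋-trans (⊕-zeroˡ (0# ∷ ((p ⊗ q) ⊗ r)) (⊙-zero r)) (∷-cong refl (⊗-assoc p q r))))

  const-⊗ : ∀ a p → (a ∷ []) ⊗ p ≋ a ⊙ p
  const-⊗ a p = ⊕-zeroʳ (a ⊙ p) (≋-sym []≋0∷[])

  ⊗-identityʳ : ∀ p → p ⊗ oneₚ F ≋ p
  ⊗-identityʳ p = ≋-trans (⊗-comm p (oneₚ F)) (≋-trans (const-⊗ 1# p) (⊙-identity p))

  eval : Poly F → Carrier → Carrier
  eval []      x = 0#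
  eval (a ∷ p) x = a + x * eval p x

  eval-zero : ∀ p x → p ≋ [] → eval p x ≈ 0#
  eval-zero []      x z = refl
  eval-zero (a ∷ p) x z = begin
    a + x * eval p x   ≈⟨ +-cong (at z zero) (*-congˡ (eval-zero p x (∷-tail (≋-trans z []≋0∷[])))) ⟩
    0# + x * 0#        ≈⟨ +-identityˡ _ ⟩
    x * 0#             ≈⟨ zeroʳ x ⟩
    0#                 ∎
    where open ≈-Reasoning

  eval-cong : ∀ {p q} x → p ≋ q → eval p x ≈ eval q x
  eval-cong {[]}    {[]}    x e = refl
  eval-cong {[]}    {b ∷ q} x e = sym (eval-zero (b ∷ q) x (≋-sym e))
  eval-cong {a ∷ p} {[]}    x e = eval-zero (a ∷ p) x e
  eval-cong {a ∷ p} {b ∷ q} x e = +-cong (at e zero) (*-congˡ (eval-cong x (∷-tail e)))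

  eval-⊕ : ∀ p q x → eval (p ⊕ q) x ≈ eval p x + eval q x
  eval-⊕ []      q       x = sym (+-identityˡ _)
  eval-⊕ (a ∷ p) []      x = sym (+-identityʳ _)
  eval-⊕ (a ∷ p) (b ∷ q) x = begin
    (a + b) + x * eval (p ⊕ q) x               ≈⟨ +-congˡ (*-congˡ (eval-⊕ p q x)) ⟩
    (a + b) + x * (eval p x + eval q x)        ≈⟨ +-congˡ (distribˡ _ _ _) ⟩
    (a + b) + (x * eval p x + x * eval q x)    ≈⟨ interchange _ _ _ _ ⟩
    (a + x * eval p x) + (b + x * eval q x)    ∎
    where open ≈-Reasoning

  eval-⊙ : ∀ a p x → eval (a ⊙ p) x ≈ a * eval p x
  eval-⊙ a []      x = sym (zeroʳ a)
  eval-⊙ a (b ∷ p) x = begin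
    a * b + x * eval (a ⊙ p) x   ≈⟨ +-congˡ (*-congˡ (eval-⊙ a p x)) ⟩
    a * b + x * (a * eval p x)   ≈⟨ +-congˡ (x∙yz≈y∙xz x a _) ⟩
    a * b + a * (x * eval p x)   ≈⟨ distribˡ a b _ ⟨
    a * (b + x * eval p x)       ∎
    where open ≈-Reasoning

  eval-⊗ : ∀ p q x → eval (p ⊗ q) x ≈ eval p x * eval q x
  eval-⊗ []      q x = sym (zeroˡ _)
  eval-⊗ (a ∷ p) q x = begin
    eval (a ⊙ q ⊕ (0# ∷ (p ⊗ q))) x                  ≈⟨ eval-⊕ (a ⊙ q) (0# ∷ (p ⊗ q)) x ⟩
    eval (a ⊙ q) x + (0# + x * eval (p ⊗ q) x)       ≈⟨ +-cong (eval-⊙ a q x) (+-identityˡ _) ⟩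
    a * eval q x + x * eval (p ⊗ q) x                ≈⟨ +-congˡ (*-congˡ (eval-⊗ p q x)) ⟩
    a * eval q x + x * (eval p x * eval q x)         ≈⟨ +-congˡ (*-assoc x _ _) ⟨
    a * eval q x + (x * eval p x) * eval q x         ≈⟨ distribʳ (eval q x) a _ ⟨
    (a + x * eval p x) * eval q x                    ∎
    where open ≈-Reasoning

  difference-of-squares : ∀ p z → (p ⊕ (- z ∷ [])) ⊗ (p ⊕ (z ∷ [])) ≋ p ⊗ p ⊕ (- (z * z) ∷ [])
  difference-of-squares p z = begin
    (p ⊕ [-z]) ⊗ (p ⊕ [z])                          ≈⟨ ⊗-distribʳ p [-z] (p ⊕ [z]) ⟩
    p ⊗ (p ⊕ [z]) ⊕ [-z] ⊗ (p ⊕ [z])                ≈⟨ ⊕-cong (⊗-distribˡ p p [z]) (const-⊗ (- z) (p ⊕ [z])) ⟩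
    (p ⊗ p ⊕ p ⊗ [z]) ⊕ (- z) ⊙ (p ⊕ [z])           ≈⟨ ⊕-cong (⊕-cong ≋-refl (≋-trans (⊗-comm p [z]) (const-⊗ z p)))
                                                                (⊙-distribˡ (- z) p [z]) ⟩
    (p ⊗ p ⊕ z ⊙ p) ⊕ ((- z) ⊙ p ⊕ ((- z) * z ∷ [])) ≈⟨ ⊕-assoc (p ⊗ p) (z ⊙ p) _ ⟩
    p ⊗ p ⊕ (z ⊙ p ⊕ ((- z) ⊙ p ⊕ ((- z) * z ∷ [])))  ≈⟨ ⊕-cong (≋-refl {p ⊗ p}) (⊕-assoc (z ⊙ p) ((- z) ⊙ p) _) ⟨
    p ⊗ p ⊕ ((z ⊙ p ⊕ (- z) ⊙ p) ⊕ ((- z) * z ∷ [])) ≈⟨ ⊕-cong (≋-refl {p ⊗ p}) (⊕-zeroˡ _ z-z≋0) ⟩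
    p ⊗ p ⊕ ((- z) * z ∷ [])                        ≈⟨ ⊕-cong (≋-refl {p ⊗ p}) (∷-cong (sym (-‿distribˡ-* z z)) ≋-refl) ⟩
    p ⊗ p ⊕ (- (z * z) ∷ [])                        ∎
    where
    open ≋-Reasoning
    [z] [-z] : Poly F
    [z] = z ∷ []
    [-z] = - z ∷ []
    z-z≋0 : z ⊙ p ⊕ (- z) ⊙ p ≋ []
    z-z≋0 = ≋-trans (≋-sym (⊙-distribʳ z (- z) p)) (≋-trans (⊙-cong (-‿inverseʳ z) ≋-refl) (⊙-zero p))

  eval-⊕-constant : ∀ p e x → eval (p ⊕ (e ∷ [])) x ≈ eval p x + e
  eval-⊕-constant p e x =
    trans (eval-⊕ p (e ∷ []) x) (+-congˡ (trans (+-congˡ (zeroʳ x)) (+-identityʳ e)))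

  X-_ : Carrier → Poly F
  X- r = (- r) ∷ 1# ∷ []

  eval-X- : ∀ r → eval (X- r) r ≈ 0#
  eval-X- r = begin
    - r + r * (1# + r * 0#)   ≈⟨ +-congˡ (*-congˡ (trans (+-congˡ (zeroʳ r)) (+-identityʳ 1#))) ⟩
    - r + r * 1#              ≈⟨ +-congˡ (*-identityʳ r) ⟩
    - r + r                   ≈⟨ -‿inverseˡ r ⟩
    0#                        ∎
    where open ≈-Reasoning

  X-⊗ : ∀ r W → (X- r) ⊗ W ≋ (0# ∷ W) ⊕ (- r) ⊙ W
  X-⊗ r W = ≋-trans (⊕-cong (≋-refl {(- r) ⊙ W}) (∷-cong refl (≋-trans (const-⊗ 1# W) (⊙-identity W))))
                   (⊕-comm ((- r) ⊙ W) (0# ∷ W))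

  divide : ∀ B r → Σ (Poly F) λ Q → B ≋ (X- r) ⊗ Q ⊕ (eval B r ∷ [])
  divide []       r = [] , ≋-trans []≋0∷[] (≋-sym (⊕-zeroˡ (0# ∷ []) (⊗-zeroʳ (X- r))))
  divide (b ∷ B₀) r with divide B₀ r
  ... | Q₀ , B₀≋ = (E₀ ∷ Q₀) , ≋-sym (≋-trans
        (⊕-cong (⊗-∷ʳ (X- r) E₀ Q₀) (≋-refl {(b + r * E₀) ∷ []}))
        (∷-cong constant-term higher-terms))
    where
    E₀ : Carrier
    E₀ = eval B₀ r
    constant-term : (E₀ * - r + 0#) + (b + r * E₀) ≈ b
    constant-term = begin
      (E₀ * - r + 0#) + (b + r * E₀)   ≈⟨ +-cong (+-identityʳ _) (+-comm b _) ⟩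
      E₀ * - r + (r * E₀ + b)          ≈⟨ +-assoc _ _ b ⟨
      (E₀ * - r + r * E₀) + b          ≈⟨ +-congʳ (+-cong (sym (-‿distribʳ-* E₀ r)) (*-comm r E₀)) ⟩
      (- (E₀ * r) + E₀ * r) + b        ≈⟨ +-congʳ (-‿inverseˡ _) ⟩
      0# + b                           ≈⟨ +-identityˡ b ⟩
      b                                ∎
      where open ≈-Reasoning
    higher-terms : ((E₀ * 1#) ∷ []) ⊕ (X- r) ⊗ Q₀ ⊕ [] ≋ B₀
    higher-terms = begin
      ((E₀ * 1#) ∷ []) ⊕ (X- r) ⊗ Q₀ ⊕ []   ≈⟨ ⊕-zeroʳ _ ≋-refl ⟩
      ((E₀ * 1#) ∷ []) ⊕ (X- r) ⊗ Q₀        ≈⟨ ⊕-comm ((E₀ * 1#) ∷ []) ((X- r) ⊗ Q₀) ⟩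
      (X- r) ⊗ Q₀ ⊕ ((E₀ * 1#) ∷ [])        ≈⟨ ⊕-cong ≋-refl (∷-cong (*-identityʳ E₀) ≋-refl) ⟩
      (X- r) ⊗ Q₀ ⊕ (E₀ ∷ [])               ≈⟨ B₀≋ ⟨
      B₀                                    ∎
      where open ≋-Reasoning

  factor : ∀ B r → eval B r ≈ 0# → Σ (Poly F) λ Q → B ≋ (X- r) ⊗ Q
  factor B r B[r]≈0 with divide B r
  ... | Q , B≋ = Q , ≋-trans B≋ (⊕-zeroʳ _ (≋-trans (∷-cong B[r]≈0 ≋-refl) (≋-sym []≋0∷[])))

  -- x - r is not a zero divisor: a constant e plus (x - r)·W vanishes only
  -- when e and W both vanish.
  X-⊗-kernel : ∀ r e W → (e ∷ W) ⊕ (- r) ⊙ W ≋ [] → W ≋ [] × e ≈ 0#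
  X-⊗-kernel r e []       z = ≋-refl , at z zero
  X-⊗-kernel r e (w ∷ W₀) z with X-⊗-kernel r w W₀ (∷-tail (≋-trans z []≋0∷[]))
  ... | W₀≋0 , w≈0 = ≋-trans (∷-cong w≈0 W₀≋0) (≋-sym []≋0∷[]) , (begin
      e              ≈⟨ +-identityʳ e ⟨
      e + 0#         ≈⟨ +-congˡ (trans (sym (zeroʳ (- r))) (*-congˡ (sym w≈0))) ⟩
      e + - r * w    ≈⟨ at z zero ⟩
      0#             ∎)
    where open ≈-Reasoning

  X-⊗-cancel : ∀ r U V → (X- r) ⊗ U ≋ (X- r) ⊗ V → U ≋ V
  X-⊗-cancel r U V e = begin
    U                   ≈⟨ ⊕-zeroʳ U (≋-trans (⊕-comm (⊖ V) V) (⊕-inverseʳ V)) ⟨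
    U ⊕ (⊖ V ⊕ V)       ≈⟨ ⊕-assoc U (⊖ V) V ⟨
    (U ⊕ ⊖ V) ⊕ V       ≈⟨ ⊕-zeroˡ V U-V≋0 ⟩
    V                   ∎
    where
    open ≋-Reasoning
    U-V≋0 : U ⊕ ⊖ V ≋ []
    U-V≋0 = proj₁ (X-⊗-kernel r 0# (U ⊕ ⊖ V) (begin
      (0# ∷ (U ⊕ ⊖ V)) ⊕ (- r) ⊙ (U ⊕ ⊖ V)   ≈⟨ X-⊗ r (U ⊕ ⊖ V) ⟨
      (X- r) ⊗ (U ⊕ ⊖ V)                      ≈⟨ ⊗-distribˡ (X- r) U (⊖ V) ⟩
      (X- r) ⊗ U ⊕ (X- r) ⊗ ⊖ V               ≈⟨ ⊕-cong e (⊗-⊙ʳ (- 1#) (X- r) V) ⟩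
      (X- r) ⊗ V ⊕ ⊖ ((X- r) ⊗ V)             ≈⟨ ⊕-inverseʳ ((X- r) ⊗ V) ⟩
      []                                      ∎))

  -- Degrees.  A coefficient list is reduced when its last entry is nonzero;
  -- its length is then the degree plus one.
  data Reduced : Poly F → Set (c ⊔ ℓ) where
    [_] : ∀ {a} → ¬ a ≈ 0# → Reduced (a ∷ [])
    _∷_ : ∀ a {p} → Reduced p → Reduced (a ∷ p)

  NonConstant : Poly F → Set (c ⊔ ℓ)
  NonConstant p = Reduced p × 2 ≤ length p

  reduced-nonzero : ∀ {p} → Reduced p → ¬ p ≋ []
  reduced-nonzero [ a≉0 ] z = a≉0 (at z zero)
  reduced-nonzero (a ∷ r) z = reduced-nonzero r (∷-tail (≋-trans z []≋0∷[]))

  reduced-length : ∀ {p q} → Reduced p → Reduced q → p ≋ q → length p ≡ length q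
  reduced-length [ _ ]   [ _ ]   e = ≡.refl
  reduced-length [ _ ]   (b ∷ r) e = ⊥-elim (reduced-nonzero r (≋-sym (∷-tail e)))
  reduced-length (a ∷ r) [ _ ]   e = ⊥-elim (reduced-nonzero r (∷-tail e))
  reduced-length (a ∷ r) (b ∷ s) e = ≡.cong suc (reduced-length r s (∷-tail e))

  ⊙-length : ∀ a p → length (a ⊙ p) ≡ length p
  ⊙-length a []      = ≡.refl
  ⊙-length a (b ∷ p) = ≡.cong suc (⊙-length a p)

  ⊙-reduced : ∀ {a p} → ¬ a ≈ 0# → Reduced p → Reduced (a ⊙ p)
  ⊙-reduced a≉0 [ b≉0 ] = [ nonzero-* a≉0 b≉0 ]
  ⊙-reduced a≉0 (b ∷ r) = _ ∷ ⊙-reduced a≉0 r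

  ⊕-reduced : ∀ u {v} → length u < length v → Reduced v →
              Reduced (u ⊕ v) × length (u ⊕ v) ≡ length v
  ⊕-reduced []       _               r       = r , ≡.refl
  ⊕-reduced (x ∷ u) {_ ∷ []}     (s≤s ())  _
  ⊕-reduced (x ∷ u) {_ ∷ _ ∷ _} (s≤s lt) (y ∷ r) with ⊕-reduced u lt r
  ... | r′ , same = _ ∷ r′ , ≡.cong suc same

  ⊕-constant : ∀ {p} e → NonConstant p → NonConstant (p ⊕ (e ∷ []))
  ⊕-constant {_ ∷ []}    e ([ _ ] , s≤s ())
  ⊕-constant {_ ∷ _ ∷ _} e (_ ∷ r , deg) = (_ ∷ r) , deg

  summand-≤ : ∀ {A n m} → Reduced A → length A +ℕ n ≡ suc m → n ≤ m
  summand-≤ {_ ∷ A} {n} _ eq =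
    ℕ.≤-trans (ℕ.m≤n+m n (length A)) (ℕ.≤-reflexive (ℕ.suc-injective eq))

  ⊗-reduced : ∀ {A B} → Reduced A → Reduced B →
              Reduced (A ⊗ B) × length A +ℕ length B ≡ suc (length (A ⊗ B))
  ⊗-reduced {a ∷ []} {b ∷ []} [ a≉0 ] [ b≉0 ] =
    [ (λ ab+0≈0 → nonzero-* a≉0 b≉0 (trans (sym (+-identityʳ _)) ab+0≈0)) ] , ≡.refl
  ⊗-reduced {a ∷ []} {b ∷ b′ ∷ B} [ a≉0 ] (_ ∷ r) =
    proj₁ (⊕-constant 0# (⊙-reduced a≉0 (_ ∷ r) , s≤s (s≤s z≤n))) ,
    ≡.cong (λ n → suc (suc (suc n))) (≡.sym (⊙-length a B))
  ⊗-reduced {a ∷ A} {B} (_ ∷ rA) rB with ⊗-reduced rA rB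
  ... | rAB , deg with ⊕-reduced (a ⊙ B) (s≤s shorter) (0# ∷ rAB)
    where
    shorter : length (a ⊙ B) ≤ length (A ⊗ B)
    shorter = ℕ.≤-trans (ℕ.≤-reflexive (⊙-length a B)) (summand-≤ rA deg)
  ... | r , same = r , ≡.cong suc (≡.trans deg (≡.sym same))

  linear-factor : ∀ {a a⁻¹} b → a * a⁻¹ ≈ 1# → b ∷ a ∷ [] ≋ a ⊙ X- (- (b * a⁻¹))
  linear-factor {a} {a⁻¹} b aa⁻¹≈1 = ∷-cong (begin
    b                  ≈⟨ *-identityʳ b ⟨
    b * 1#             ≈⟨ *-congˡ aa⁻¹≈1 ⟨
    b * (a * a⁻¹)      ≈⟨ x∙yz≈y∙xz b a a⁻¹ ⟩
    a * (b * a⁻¹)      ≈⟨ *-congˡ (-‿involutive _) ⟨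
    a * - - (b * a⁻¹)  ∎) (∷-cong (sym (*-identityʳ a)) ≋-refl)
    where open ≈-Reasoning

  cancel-linear : ∀ {a a⁻¹} r Q A B′ → a * a⁻¹ ≈ 1# →
                  (a ⊙ X- r) ⊗ Q ≋ A ⊗ ((X- r) ⊗ B′) → Q ≋ A ⊗ (a⁻¹ ⊙ B′)
  cancel-linear {a} {a⁻¹} r Q A B′ aa⁻¹≈1 e = begin
    Q                  ≈⟨ ⊙-identity Q ⟨
    1# ⊙ Q             ≈⟨ ⊙-cong (trans (sym aa⁻¹≈1) (*-comm a a⁻¹)) ≋-refl ⟩
    (a⁻¹ * a) ⊙ Q      ≈⟨ ⊙-assoc a⁻¹ a Q ⟨
    a⁻¹ ⊙ (a ⊙ Q)      ≈⟨ ⊙-cong refl aQ≋AB′ ⟩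
    a⁻¹ ⊙ (A ⊗ B′)     ≈⟨ ⊗-⊙ʳ a⁻¹ A B′ ⟨
    A ⊗ (a⁻¹ ⊙ B′)     ∎
    where
    open ≋-Reasoning
    aQ≋AB′ : a ⊙ Q ≋ A ⊗ B′
    aQ≋AB′ = X-⊗-cancel r (a ⊙ Q) (A ⊗ B′) (begin
      (X- r) ⊗ (a ⊙ Q)      ≈⟨ ⊗-⊙ʳ a (X- r) Q ⟩
      a ⊙ ((X- r) ⊗ Q)      ≈⟨ ⊗-⊙ˡ a (X- r) Q ⟨
      (a ⊙ X- r) ⊗ Q        ≈⟨ e ⟩
      A ⊗ ((X- r) ⊗ B′)     ≈⟨ ⊗-assoc A (X- r) B′ ⟨
      (A ⊗ X- r) ⊗ B′       ≈⟨ ⊗-congˡ B′ (⊗-comm A (X- r)) ⟩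
      ((X- r) ⊗ A) ⊗ B′     ≈⟨ ⊗-assoc (X- r) A B′ ⟩
      (X- r) ⊗ (A ⊗ B′)     ∎)

  root-passes-to-cofactor : ∀ L Q A B r → eval L r ≈ 0# → A ⊗ B ≋ L ⊗ Q →
                            ¬ eval A r ≈ 0# → eval B r ≈ 0#
  root-passes-to-cofactor L Q A B r L[r]≈0 e A[r]≉0 = nonzero-cancel A[r]≉0 (begin
    eval A r * eval B r     ≈⟨ eval-⊗ A B r ⟨
    eval (A ⊗ B) r          ≈⟨ eval-cong r e ⟩
    eval (L ⊗ Q) r          ≈⟨ eval-⊗ L Q r ⟩
    eval L r * eval Q r     ≈⟨ *-congʳ L[r]≈0 ⟩
    0# * eval Q r           ≈⟨ zeroˡ _ ⟩
    0#                      ∎)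
    where open ≈-Reasoning

  product : List (Linear F) → Poly F
  product = foldr (λ l acc → linPoly F l ⊗ acc) (oneₚ F)

  -- The arguments below need to decide whether a field element vanishes.
  module Factorisation (_≟_ : ∀ x y → Dec (x ≈ y)) where

    reduce : ∀ p → p ≋ [] ⊎ Σ (Poly F) λ q → Reduced q × p ≋ q
    reduce []      = inj₁ ≋-refl
    reduce (a ∷ p) with reduce p
    ... | inj₂ (q , r , p≋q) = inj₂ (a ∷ q , a ∷ r , ∷-cong refl p≋q)
    ... | inj₁ p≋0 with a ≟ 0#
    ...   | yes a≈0 = inj₁ (≋-trans (∷-cong a≈0 p≋0) (≋-sym []≋0∷[]))
    ...   | no  a≉0 = inj₂ (a ∷ [] , [ a≉0 ] , ∷-cong refl p≋0)

    nonconstant-not-unit : ∀ {A} B → NonConstant A → ¬ oneₚ F ≋ A ⊗ B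
    nonconstant-not-unit {A} B (rA , 2≤deg) 1≋AB with reduce B
    ... | inj₁ B≋0 = 1≉0 (at (≋-trans 1≋AB (≋-trans (⊗-congʳ A B≋0) (⊗-zeroʳ A))) zero)
    ... | inj₂ (B′ , rB′ , B≋B′) with ⊗-reduced rA rB′
    ...   | rAB′ , deg = 2≰1 (ℕ.≤-trans 2≤deg (summand-≤ rB′ (≡.trans (ℕ.+-comm (length B′) (length A))
                           (≡.trans deg (≡.cong suc (≡.sym one-length))))))
      where
      one-length : 1 ≡ length (A ⊗ B′)
      one-length = reduced-length [ 1≉0 ] rAB′ (≋-trans 1≋AB (⊗-congʳ A B≋B′))
      2≰1 : ¬ 2 ≤ 1
      2≰1 (s≤s ())

    -- If A·B is a product of linear polynomials and A is nonconstant, then A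
    -- has a root: peel off the linear factors one at a time; a factor whose
    -- root is not a root of A divides B and can be cancelled.
    root-of-divisor : ∀ ls A B → NonConstant A → product ls ≋ A ⊗ B →
                      Σ Carrier λ r → eval A r ≈ 0#
    root-of-divisor []                       A B ncA e = ⊥-elim (nonconstant-not-unit B ncA e)
    root-of-divisor (((a , b) , a≉0) ∷ ls) A B ncA e with inverse a a≉0
    ... | a⁻¹ , aa⁻¹≈1 with eval A (- (b * a⁻¹)) ≟ 0#
    ...   | yes A[r]≈0 = - (b * a⁻¹) , A[r]≈0
    ...   | no  A[r]≉0 = root-of-divisor ls A (a⁻¹ ⊙ B′) ncA
                           (cancel-linear r Q A B′ aa⁻¹≈1 (begin
                             (a ⊙ X- r) ⊗ Q        ≈⟨ ⊗-congˡ Q (linear-factor b aa⁻¹≈1) ⟨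
                             (b ∷ a ∷ []) ⊗ Q      ≈⟨ e ⟩
                             A ⊗ B                 ≈⟨ ⊗-congʳ A B≋X-rB′ ⟩
                             A ⊗ ((X- r) ⊗ B′)     ∎))
      where
      open ≋-Reasoning
      r : Carrier
      r = - (b * a⁻¹)
      Q : Poly F
      Q = product ls
      B[r]≈0 : eval B r ≈ 0#
      B[r]≈0 = root-passes-to-cofactor (b ∷ a ∷ []) Q A B r
        (trans (eval-cong r (linear-factor b aa⁻¹≈1))
               (trans (eval-⊙ a (X- r) r) (trans (*-congˡ (eval-X- r)) (zeroʳ a))))
        (≋-sym e) A[r]≉0
      B′ : Poly F
      B′ = proj₁ (factor B r B[r]≈0)
      B≋X-rB′ : B ≋ (X- r) ⊗ B′
      B≋X-rB′ = proj₂ (factor B r B[r]≈0)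

module IteratedSquares {c ℓ : Level} (F : Field c ℓ) (cs : ℕ → Field.Carrier F) where
  open Field F hiding (zero)
  open Polynomials F
  open import Algebra.Properties.Ring ring using (-‿distribˡ-*; -‿distribʳ-*; -‿involutive; -‿+-comm; -0#≈0#; x∙y⁻¹≈ε⇒x≈y)
  open import Algebra.Properties.CommutativeSemigroup +-commutativeSemigroup using (x∙yz≈y∙xz)

  P : ℕ → Poly F
  P = iterPoly F cs

  step : ℕ → Carrier → Carrier
  step t y = y * y + - cs (suc t)

  steps : ℕ → ℕ → Carrier → Carrier
  steps t zero    y = y
  steps t (suc d) y = steps (suc t) d (step t y)

  step-cong : ∀ t {x y} → x ≈ y → step t x ≈ step t y
  step-cong t x≈y = +-congʳ (*-cong x≈y x≈y)

  step-even : ∀ t w → step t (- w) ≈ step t w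
  step-even t w = +-congʳ (begin
    (- w) * (- w)     ≈⟨ -‿distribˡ-* w (- w) ⟨
    - (w * - w)       ≈⟨ -‿cong (-‿distribʳ-* w w) ⟨
    - (- (w * w))     ≈⟨ -‿involutive _ ⟩
    w * w             ∎)
    where open ≈-Reasoning

  steps-cong : ∀ t d {x y} → x ≈ y → steps t d x ≈ steps t d y
  steps-cong t zero    x≈y = x≈y
  steps-cong t (suc d) x≈y = steps-cong (suc t) d (step-cong t x≈y)

  steps-zero : ∀ t d → (∀ m → t < m → m ≤ t +ℕ d → cs m ≈ 0#) → steps t d 0# ≈ 0#
  steps-zero t zero    _        = refl
  steps-zero t (suc d) c-vanish = trans (steps-cong (suc t) d step-0) (steps-zero (suc t) d c-vanish′)
    where
    shift : suc t +ℕ d ≤ t +ℕ suc d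
    shift = ℕ.≤-reflexive (≡.sym (ℕ.+-suc t d))
    c-vanish′ : ∀ m → suc t < m → m ≤ suc t +ℕ d → cs m ≈ 0#
    c-vanish′ m lt le = c-vanish m (ℕ.<-trans (ℕ.n<1+n t) lt) (ℕ.≤-trans le shift)
    step-0 : step t 0# ≈ 0#
    step-0 = begin
      0# * 0# + - cs (suc t)   ≈⟨ +-cong (zeroˡ 0#) (-‿cong (c-vanish (suc t) ℕ.≤-refl (ℕ.≤-trans (ℕ.m≤m+n (suc t) d) shift))) ⟩
      0# + - 0#                ≈⟨ +-identityˡ _ ⟩
      - 0#                     ≈⟨ -0#≈0# ⟩
      0#                       ∎
      where open ≈-Reasoning

  eval-P : ∀ t x → eval (P (suc t)) x ≈ step t (eval (P t) x)
  eval-P t x = trans (eval-⊕-constant (P t ⊗ P t) (- cs (suc t)) x) (+-congʳ (eval-⊗ (P t) (P t) x))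

  P-nonconstant : ∀ t → NonConstant (P t)
  P-nonconstant zero    = (0# ∷ [ 1≉0 ]) , s≤s (s≤s z≤n)
  P-nonconstant (suc t) with P-nonconstant t
  ... | reduced , 2≤deg with ⊗-reduced reduced reduced
  ...   | reduced² , deg² = ⊕-constant (- cs (suc t)) (reduced² , long)
    where
    long : 2 ≤ length (P t ⊗ P t)
    long = ℕ.≤-trans 2≤deg (summand-≤ reduced deg²)

  one-step : ∀ t z → (P t ⊕ (- z ∷ [])) ⊗ (P t ⊕ (z ∷ [])) ≋ P (suc t) ⊕ (- step t z ∷ [])
  one-step t z = ≋-trans (difference-of-squares (P t) z)
    (≋-trans (⊕-cong (≋-refl {P t ⊗ P t}) (∷-cong split-constant ≋-refl))
    (≋-sym (⊕-assoc (P t ⊗ P t) (- cₜ ∷ []) (- step t z ∷ []))))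
    where
    cₜ : Carrier
    cₜ = cs (suc t)
    split-constant : - (z * z) ≈ - cₜ + - (z * z + - cₜ)
    split-constant = begin
      - (z * z)                      ≈⟨ +-identityʳ _ ⟨
      - (z * z) + 0#                 ≈⟨ +-congˡ (-‿inverseˡ cₜ) ⟨
      - (z * z) + (- cₜ + cₜ)        ≈⟨ x∙yz≈y∙xz _ _ _ ⟩
      - cₜ + (- (z * z) + cₜ)        ≈⟨ +-congˡ (+-congˡ (-‿involutive cₜ)) ⟨
      - cₜ + (- (z * z) + - - cₜ)    ≈⟨ +-congˡ (-‿+-comm _ _) ⟩
      - cₜ + - (z * z + - cₜ)        ∎
      where open ≈-Reasoning

  P-divides : ∀ t d z {m} → t +ℕ d ≡ m →
              Σ (Poly F) λ B → (P t ⊕ (- z ∷ [])) ⊗ B ≋ P m ⊕ (- steps t d z ∷ [])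
  P-divides t zero z t+0≡m with ≡.trans (≡.sym (ℕ.+-identityʳ t)) t+0≡m
  ... | ≡.refl = oneₚ F , ⊗-identityʳ _
  P-divides t (suc d) z t+d≡m with P-divides (suc t) d (step t z) (≡.trans (≡.sym (ℕ.+-suc t d)) t+d≡m)
  ... | B , div = (P t ⊕ (z ∷ [])) ⊗ B , (begin
    (P t ⊕ (- z ∷ [])) ⊗ ((P t ⊕ (z ∷ [])) ⊗ B)    ≈⟨ ⊗-assoc (P t ⊕ (- z ∷ [])) _ B ⟨
    ((P t ⊕ (- z ∷ [])) ⊗ (P t ⊕ (z ∷ []))) ⊗ B    ≈⟨ ⊗-congˡ B (one-step t z) ⟩
    (P (suc t) ⊕ (- step t z ∷ [])) ⊗ B           ≈⟨ div ⟩
    _                                              ∎)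
    where open ≋-Reasoning

  module Crumbling (2≉0 : CharNot2 F) (_≟_ : ∀ x y → Dec (x ≈ y))
                   (k : ℕ) (ls : List (Linear F)) (crumbles : product ls ≋ P k) where
    open Factorisation _≟_
    open FieldFacts F using (unique-length)
    open import Data.List.Relation.Unary.Unique.Setoid setoid using (Unique)
    open import Data.List.Relation.Unary.AllPairs using ([]; _∷_)
    open All using (All; []; _∷_)

    -- If steps t d z = 0 with t + d = k, then z is a value of P_t: the factor
    -- P_t - z of the crumbling P_k has a root.
    value-of-P : ∀ t d z → t +ℕ d ≡ k → steps t d z ≈ 0# → Σ Carrier λ r → eval (P t) r ≈ z
    value-of-P t d z t+d≡k steps≈0 with P-divides t d z t+d≡k
    ... | B , div with root-of-divisor ls (P t ⊕ (- z ∷ [])) B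
                         (⊕-constant (- z) (P-nonconstant t)) (≋-trans crumbles P-k≋)
      where
      P-k≋ : P k ≋ (P t ⊕ (- z ∷ [])) ⊗ B
      P-k≋ = ≋-trans (≋-sym (⊕-zeroʳ (P k) (≋-trans (∷-cong (trans (-‿cong steps≈0) -0#≈0#) ≋-refl)
                                                     (≋-sym []≋0∷[]))))
                     (≋-sym div)
    ... | r , root = r , x∙y⁻¹≈ε⇒x≈y _ _ (trans (sym (eval-⊕-constant (P t) (- z) r)) root)

    record Zeros (t d : ℕ) : Set (c ⊔ ℓ) where
      field
        level    : t +ℕ d ≡ k
        elements : List Carrier
        distinct : Unique elements
        vanish   : All (λ y → steps t d y ≈ 0#) elements
    open Zeros

    size : ∀ {t d} → Zeros t d → ℕ
    size Z = length (elements Z)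

    -- Going down one level: the zeros at level t are the preimages under
    -- step t of the zeros at level t + 1, all of which are attained.
    module Descend {t d : ℕ} (Z : Zeros (suc t) d) where
      open EvenMaps F 2≉0 _≟_ (step t) (step-cong t) (step-even t) public
      open PreimageList

      attained : All InImage (elements Z)
      attained = All.map (λ {y} vanishes → let (r , P[r]≈y) = value-of-P (suc t) d y (level Z) vanishes
                                            in eval (P t) r , trans (sym (eval-P t r)) P[r]≈y)
                         (vanish Z)

      lift : PreimageList (elements Z) → Zeros t (suc d)
      lift E = record
        { level    = ≡.trans (ℕ.+-suc t d) (level Z)
        ; elements = elements E
        ; distinct = distinct E
        ; vanish   = All.map (All.lookupₛ setoid (λ x≈y v → trans (sym (steps-cong (suc t) d x≈y)) v) (vanish Z))
                             (maps-into E) }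

    descend : ∀ {t d} (Z : Zeros (suc t) d) →
              Σ (Zeros t (suc d)) λ Z′ → size Z +ℕ size Z ≤ suc (size Z′)
    descend Z = Product.map lift (λ bound → bound) (preimages (elements Z) (distinct Z) attained)
      where open Descend Z

    descend-avoiding : ∀ {t d} (Z : Zeros (suc t) d) → All (λ y → ¬ step t 0# ≈ y) (elements Z) →
                       Σ (Zeros t (suc d)) λ Z′ → size Z +ℕ size Z ≤ size Z′
    descend-avoiding Z avoid =
      Product.map lift (λ bound → bound) (preimages-avoiding (elements Z) (distinct Z) attained avoid)
      where open Descend Z

    doubling : ∀ {g n m} → suc (2 ^ g) ≤ n → n +ℕ n ≤ suc m → suc (2 ^ suc g) ≤ m
    doubling {g} {n} {m} big bound = ℕ.≤-pred (begin
      suc (suc (2 ^ g +ℕ (2 ^ g +ℕ 0)))  ≡⟨ ≡.cong (λ x → suc (suc (2 ^ g +ℕ x))) (ℕ.+-identityʳ (2 ^ g)) ⟩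
      suc (suc (2 ^ g +ℕ 2 ^ g))         ≡⟨ ≡.cong suc (ℕ.+-suc (2 ^ g) (2 ^ g)) ⟨
      suc (2 ^ g) +ℕ suc (2 ^ g)         ≤⟨ ℕ.+-mono-≤ big big ⟩
      n +ℕ n                             ≤⟨ bound ⟩
      suc m                              ∎)
      where open ℕ.≤-Reasoning

    module LastNonzero (s e : ℕ) (level : suc s +ℕ e ≡ k) (c≉0 : ¬ cs (suc s) ≈ 0#)
                       (c-vanish : ∀ m → suc s < m → m ≤ k → cs m ≈ 0#) where

      top : Zeros (suc s) e
      top = record
        { level    = level
        ; elements = 0# ∷ []
        ; distinct = [] ∷ []
        ; vanish   = steps-zero (suc s) e (λ m lt le → c-vanish m lt (≡.subst (m ≤_) level le)) ∷ [] }

      step-0≉0 : ¬ step s 0# ≈ 0#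
      step-0≉0 step-0≈0 = c≉0 (begin
        cs (suc s)                ≈⟨ -‿involutive _ ⟨
        - - cs (suc s)            ≈⟨ -‿cong (+-identityˡ _) ⟨
        - (0# + - cs (suc s))     ≈⟨ -‿cong (+-congʳ (zeroˡ 0#)) ⟨
        - step s 0#               ≈⟨ -‿cong step-0≈0 ⟩
        - 0#                      ≈⟨ -0#≈0# ⟩
        0#                        ∎)
        where open ≈-Reasoning

      many-zeros : ∀ g t → t +ℕ g ≡ s → Σ (Zeros t (suc g +ℕ e)) λ Z → suc (2 ^ g) ≤ size Z
      many-zeros zero t t+0≡s with ≡.trans (≡.sym (ℕ.+-identityʳ t)) t+0≡s
      ... | ≡.refl = descend-avoiding top (step-0≉0 ∷ [])
      many-zeros (suc g) t t+g≡s with many-zeros g (suc t) (≡.trans (≡.sym (ℕ.+-suc t g)) t+g≡s)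
      ... | Z , big = Product.map₂ (doubling {g} big) (descend Z)

      field-large : ∀ {q} → HasCardinality F q → 2 ^ s < q
      field-large card with many-zeros s 0 ≡.refl
      ... | Z , big = ℕ.≤-trans big (unique-length card (elements Z) (distinct Z))

corollary2 : {c ℓ : Level} (F : Field c ℓ) → CharNot2 F →
    (q : ℕ) → HasCardinality F q →
    (k : ℕ) → 1 ≤ k → (cs : ℕ → Field.Carrier F) →
    Crumbles F (iterPoly F cs k) →
    (j : ℕ) → 1 ≤ j → j ≤ k → q ≤ 2 ^ (j ∸ 1) →
    (i : ℕ) → j ≤ i → i ≤ k → Field._≈_ F (cs i) (Field.0# F)
corollary2 F 2≉0 q card k _ cs (ls , crumbles) j 1≤j _ q≤2^[j-1] i j≤i i≤k =
  decidable-stable (cs i ≟ 0#) λ cᵢ≉0 →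
    no-last-nonzero (last-failure (λ m → cs m ≟ 0#) i≤k cᵢ≉0)
  where
  open Field F using (_≈_; 0#)
  infix 4 _≟_
  _≟_ : ∀ x y → Dec (x ≈ y)
  _≟_ = FieldFacts.finite⇒decidable F card

  no-last-nonzero : (Σ ℕ λ m → i ≤ m × m ≤ k × ¬ cs m ≈ 0# × (∀ n → m < n → n ≤ k → cs n ≈ 0#)) → ⊥
  no-last-nonzero (zero  , i≤0 , _) = ℕ.<⇒≱ (ℕ.≤-trans 1≤j j≤i) i≤0
  no-last-nonzero (suc s , i≤1+s , 1+s≤k , c≉0 , c-vanish) = ℕ.<⇒≱ (field-large card) (begin
    q              ≤⟨ q≤2^[j-1] ⟩
    2 ^ (j ∸ 1)    ≤⟨ ℕ.^-monoʳ-≤ 2 (ℕ.∸-monoˡ-≤ 1 (ℕ.≤-trans j≤i i≤1+s)) ⟩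
    2 ^ s          ∎)
    where
    open IteratedSquares F cs
    open Crumbling 2≉0 _≟_ k ls (Polynomials.≈ₚ⇒≋ F crumbles)
    open LastNonzero s (k ∸ suc s) (ℕ.m+[n∸m]≡n 1+s≤k) c≉0 c-vanish
    open ℕ.≤-Reasoning
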